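{- Let $n\ge1$ and fix a Dyck path $\beta$ of length $2n+2$. The number of permutations $w\in\mathfrak{S}_{2n}$ with $p_B(w)=\beta$ equals \[1\cdot3\cdot5\cdots(2n-1)\prod_{i=1}^n h_i^*(\beta).\]
   Context: A Dyck path of length $2N$ is a lattice path from $(0,0)$ to $(2N,0)$ with steps $(1,1)$ (up) and $(1,-1)$ (down) staying weakly above the $x$-axis; the down step ending at $x$-coordinate $k$ and going from height $h$ to $h-1$ is at position $k$ with height $h$; the path is determined by its set of down-step positions. $h_i(p)$ is the height of the $i$th down step of $p$, and $h_i^*(p)=h_i(p)-1$ if there is no up step to the right of the $i$th down step, $h_i^*(p)=h_i(p)$ otherwise. Crossout procedure: for $w\in\mathfrak{S}_{2n}$ in one-line notation, repeat until all positions are marked: mark "B" at the unmarked position $i$ with smallest value $w(i)$, then mark "A" at the leftmost unmarked position. $\mathcal{B}(w)$ is the set of positions marked B. $p_B(w)$ is the Dyck path of length $2n+2$ whose down-step positions are $\{b+1:b\in\mathcal{B}(w)\}\cup\{2n+2\}$. -}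

module Defs where

open import Data.Bool using (Bool; true; false; if_then_else_; _∨_)
open import Data.Nat using (ℕ; zero; suc; _+_; _*_; _∸_; _<ᵇ_; _≡ᵇ_)
open import Data.Fin using (Fin; toℕ)
import Data.Fin.Properties as FinP
open import Data.List using (List; []; _∷_; length; filter; map; concatMap; take; drop)
open import Data.Bool.ListAction using (any)
import Data.List as L
open import Data.Vec using (Vec; []; _∷_; lookup; toList; tabulate)
import Data.Vec.Properties as VecP
import Data.Bool.Properties as BoolP
open import Data.Empty using (⊥)
open import Data.Unit using (⊤)
open import Data.Product using (_×_)
open import Relation.Binary.PropositionalEquality using (_≡_)
open import Relation.Nullary using (¬?)
open import Relation.Nullary.Decidable using (_×-dec_)
open import Data.List.Relation.Unary.Unique.Propositional using (Unique)

-- Lattice paths as step sequences: true = up step (1,1), false = down step (1,-1).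

DyckFrom : ℕ → List Bool → Set
DyckFrom zero    []            = ⊤
DyckFrom (suc h) []            = ⊥
DyckFrom h       (true ∷ s)    = DyckFrom (suc h) s
DyckFrom zero    (false ∷ s)   = ⊥
DyckFrom (suc h) (false ∷ s)   = DyckFrom h s

IsDyck : {L : ℕ} → Vec Bool L → Set
IsDyck p = DyckFrom 0 (toList p)

-- h*-values of the down steps, in order, for a path currently at height h.
-- The height of a down step from h to h-1 is h; h* subtracts 1 when no up
-- step lies to the right of that down step.
hStarsFrom : ℕ → List Bool → List ℕ
hStarsFrom h []          = []
hStarsFrom h (true ∷ s)  = hStarsFrom (suc h) s
hStarsFrom h (false ∷ s) =
  (if any (λ b → b) s then h else h ∸ 1) ∷ hStarsFrom (h ∸ 1) s

hStars : {L : ℕ} → Vec Bool L → List ℕ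
hStars p = hStarsFrom 0 (toList p)

-- Crossout procedure.  A word w : Vec (Fin m) m is the one-line notation
-- of a map [m] → [m]; position (Fin index) j stands for position toℕ j + 1.

argmin : {m : ℕ} → (Fin m → ℕ) → Fin m → List (Fin m) → Fin m
argmin val x []       = x
argmin val x (y ∷ ys) = argmin val (if val y <ᵇ val x then y else x) ys

remove : {m : ℕ} → Fin m → List (Fin m) → List (Fin m)
remove b = filter (λ y → ¬? (y FinP.≟ b))

-- Given the list of unmarked positions (left to right), returns the positions
-- marked B: mark B at the unmarked position of smallest value, then mark A at
-- the leftmost unmarked position; repeat.  The fuel argument is any bound ≥
-- the number of rounds.
crossout : {m : ℕ} → ℕ → (Fin m → ℕ) → List (Fin m) → List (Fin m)
crossout zero    val _        = []
crossout (suc f) val []       = []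
crossout (suc f) val (x ∷ xs) =
  let b = argmin val x xs in b ∷ crossout f val (drop 1 (remove b (x ∷ xs)))

-- 𝓑(w) as 1-indexed positions
Bset : {m : ℕ} → Vec (Fin m) m → List ℕ
Bset {m} w = map (λ j → suc (toℕ j)) (crossout m (λ i → toℕ (lookup w i)) (L.allFin m))

-- p_B(w) for w ∈ S_{2n}: path of length 2n+2 whose down steps are at
-- positions {b+1 : b ∈ 𝓑(w)} ∪ {2n+2}.  Step i (Fin index) is at position toℕ i + 1.
pB : (n : ℕ) → Vec (Fin (2 * n)) (2 * n) → Vec Bool (2 * n + 2)
pB n w = tabulate λ i →
  let k = suc (toℕ i) in
  if (k ≡ᵇ (2 * n + 2)) ∨ any (λ b → k ≡ᵇ suc b) (Bset w) then false else true

allWords : (m k : ℕ) → List (Vec (Fin m) k)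
allWords m zero    = [] ∷ []
allWords m (suc k) = concatMap (λ x → map (x ∷_) (allWords m k)) (L.allFin m)

IsPerm : {m : ℕ} → Vec (Fin m) m → Set
IsPerm w = Unique (toList w)

countPB : (n : ℕ) → Vec Bool (2 * n + 2) → ℕ
countPB n β =
  length (filter (λ w → unique? (toList w) ×-dec VecP.≡-dec BoolP._≟_ (pB n w) β)
                 (allWords (2 * n) (2 * n)))
  where open import Data.List.Relation.Unary.Unique.DecPropositional (FinP._≟_ {2 * n}) using (unique?)

oddProd : ℕ → ℕ
oddProd zero    = 1
oddProd (suc k) = (2 * k + 1) * oddProd k

-- Write β = U · s̄ · D, where s lists the 2n middle steps with  true = down.
-- Relabelling positions by values gives  p_B(w) = U · (marks w)‾ · D, where
-- marks w  records which letters of the word w are marked B (pB-steps); so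
-- countPB n β counts the injective words w with  marks w = s.
-- Let N_V(s) be that number over an alphabet V.  If |V| = 2j+2 with least
-- letter v, a word either starts  v y …  (marks B A …, 2j+1 choices of y) or
-- starts  x …  with v later at position i (marks A, then a B at i):
--     N_V(B A s″) = (2j+1) · N(s″),     N_V(A u) = (2j+1) · Σ_d N(u − d),
-- d ranging over the down steps of u, N taken over 2j letters.  With the
-- identity  weight (h+1) u = Σ_d weight h (u − d)  for the product of the
-- h*-values (weight-suc), induction on j gives  N(s) = (2j-1)!! · weight 1 s
-- (count-formula).

module Submission where

open import Defs
open import Data.Bool using (Bool; true; false; if_then_else_; _∨_; _∧_; not)
import Data.Bool.Properties as BoolP
open import Data.Nat using (ℕ; zero; suc; _+_; _*_; _∸_; _≤_; _<_; _≥_; z≤n; s≤s; _<ᵇ_; _≡ᵇ_)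
open import Data.Nat.Properties
open import Algebra.Properties.CommutativeSemigroup +-commutativeSemigroup using (interchange)
open import Data.Fin using (Fin; toℕ; fromℕ<) renaming (zero to fzero; suc to fsuc)
import Data.Fin.Properties as FinP
open import Data.List using (List; []; _∷_; length; map; _++_; take; drop; concatMap; allFin; tabulate; filter)
import Data.List.Properties as LP
open import Data.List.Relation.Unary.All using (All; []; _∷_)
open import Data.List.Relation.Unary.AllPairs using ([]; _∷_)
open import Data.List.Relation.Unary.Unique.Propositional using (Unique)
open import Data.Nat.ListAction using (product)
open import Data.Vec using (Vec; []; _∷_)
import Data.Vec as Vec
import Data.Vec.Properties as VecP
open import Data.Bool.ListAction using (any)
open import Data.Empty using (⊥-elim)
open import Data.Product using (_×_; _,_; proj₁; proj₂; Σ)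
open import Function using (_∘_; id)
open import Relation.Nullary using (Dec; yes; no; does; ¬?)
open import Relation.Nullary.Decidable using (_×-dec_; dec-true; dec-false)
open import Relation.Binary.PropositionalEquality

true≢false : true ≢ false
true≢false ()

∧-trueˡ : ∀ {a b} → a ∧ b ≡ true → a ≡ true
∧-trueˡ {true} _ = refl

∧-trueʳ : ∀ {a b} → a ∧ b ≡ true → b ≡ true
∧-trueʳ {true} e = e

∨-falseˡ : ∀ {a b} → a ∨ b ≡ false → a ≡ false
∨-falseˡ {false} _ = refl

∨-falseʳ : ∀ {a b} → a ∨ b ≡ false → b ≡ false
∨-falseʳ {false} e = e

not-true : ∀ {a} → not a ≡ true → a ≡ false
not-true {false} _ = refl

∧-swap : ∀ a b c → a ∧ (b ∧ c) ≡ b ∧ (a ∧ c)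
∧-swap a b c = trans (sym (BoolP.∧-assoc a b c)) (trans (cong (_∧ c) (BoolP.∧-comm a b)) (BoolP.∧-assoc b a c))

-- Here a step list s : List Bool uses  true = down step, false = up step
-- (this is the convention in which the crossout marks "B = true" become
-- the down steps of p_B).

ind : Bool → ℕ
ind true  = 1
ind false = 0

downs : List Bool → ℕ
downs []      = 0
downs (b ∷ s) = ind b + downs s

ups : List Bool → ℕ
ups []      = 0
ups (b ∷ s) = ind (not b) + ups s

hasUp : List Bool → Bool
hasUp []      = false
hasUp (b ∷ s) = not b ∨ hasUp s

hStar : ℕ → Bool → ℕ
hStar h true  = h
hStar h false = h ∸ 1

-- product of h* over the down steps of s, for a path starting at height h
-- (in β, s is followed only by the final down step, so  hasUp  decides h*)
weight : ℕ → List Bool → ℕ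
weight h []          = 1
weight h (false ∷ s) = weight (suc h) s
weight h (true ∷ s)  = hStar h (hasUp s) * weight (h ∸ 1) s

-- Σ f (s with one down step deleted), summed over all down steps of s
sumOverDowns : (List Bool → ℕ) → List Bool → ℕ
sumOverDowns f []          = 0
sumOverDowns f (true ∷ s)  = f s + sumOverDowns (λ x → f (true ∷ x)) s
sumOverDowns f (false ∷ s) = sumOverDowns (λ x → f (false ∷ x)) s

-- Deleting a down step never changes whether an up step occurs, so a factor
-- depending only on  hasUp  can be pulled out of the sum.
sumOverDowns-factor : (k : Bool → ℕ) (g : List Bool → ℕ) (s : List Bool) →
  sumOverDowns (λ x → k (hasUp x) * g x) s ≡ k (hasUp s) * sumOverDowns g s
sumOverDowns-factor k g [] = sym (*-zeroʳ (k false))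
sumOverDowns-factor k g (true ∷ s) = begin
    k (hasUp s) * g s + sumOverDowns (λ x → k (hasUp x) * g (true ∷ x)) s
  ≡⟨ cong (k (hasUp s) * g s +_) (sumOverDowns-factor k (λ x → g (true ∷ x)) s) ⟩
    k (hasUp s) * g s + k (hasUp s) * sumOverDowns (λ x → g (true ∷ x)) s
  ≡⟨ sym (*-distribˡ-+ (k (hasUp s)) (g s) _) ⟩
    k (hasUp s) * (g s + sumOverDowns (λ x → g (true ∷ x)) s) ∎
  where open ≡-Reasoning
sumOverDowns-factor k g (false ∷ s) =
  sumOverDowns-factor (λ a → k (true ∨ a)) (λ x → g (false ∷ x)) s

hStar-zero : ∀ b → hStar 0 b ≡ 0
hStar-zero true  = refl
hStar-zero false = refl

-- two down steps from height 1 go below the axis, so the weight vanishes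
weight-down-down : ∀ s → weight 1 (true ∷ true ∷ s) ≡ 0
weight-down-down s =
  trans (cong (hStar 1 (hasUp (true ∷ s)) *_) (cong (_* weight 0 s) (hStar-zero (hasUp s)))) (*-zeroʳ (hStar 1 (hasUp (true ∷ s))))

hStar-suc : ∀ h b → hStar (suc (suc h)) b ≡ suc (hStar (suc h) b)
hStar-suc h true  = refl
hStar-suc h false = refl

ups-hasUp : ∀ s → 1 ≤ ups s → hasUp s ≡ true
ups-hasUp (false ∷ s) _ = refl
ups-hasUp (true ∷ s)  p = ups-hasUp s p

weight-suc-down : ∀ h s → weight (suc h) s ≡ sumOverDowns (weight h) s →
  weight (suc (suc h)) (true ∷ s) ≡ sumOverDowns (weight (suc h)) (true ∷ s)
weight-suc-down h s ih = begin
    hStar (suc (suc h)) u * weight (suc h) s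
  ≡⟨ cong (_* weight (suc h) s) (hStar-suc h u) ⟩
    weight (suc h) s + hStar (suc h) u * weight (suc h) s
  ≡⟨ cong (λ z → weight (suc h) s + hStar (suc h) u * z) ih ⟩
    weight (suc h) s + hStar (suc h) u * sumOverDowns (weight h) s
  ≡⟨ cong (weight (suc h) s +_) (sym (sumOverDowns-factor (hStar (suc h)) (weight h) s)) ⟩
    weight (suc h) s + sumOverDowns (λ x → hStar (suc h) (hasUp x) * weight h x) s ∎
  where
  open ≡-Reasoning
  u : Bool
  u = hasUp s

weight-suc : ∀ h s → downs s ≡ ups s + h → 1 ≤ h + length s →
             weight (suc h) s ≡ sumOverDowns (weight h) s
weight-suc zero    []          _   ()
weight-suc (suc h) []          ()  _
weight-suc h       (false ∷ s) bal _ =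
  weight-suc (suc h) s (trans bal (sym (+-suc (ups s) h))) (s≤s z≤n)
weight-suc zero (true ∷ s) bal _ = begin
    hStar 1 (hasUp s) * weight 0 s
  ≡⟨ cong (λ b → hStar 1 b * weight 0 s) (ups-hasUp s (subst (1 ≤_) bal′ (s≤s z≤n))) ⟩
    weight 0 s + 0
  ≡⟨ cong (weight 0 s +_) (sym vanish) ⟩
    weight 0 s + sumOverDowns (λ x → hStar 0 (hasUp x) * weight 0 x) s ∎
  where
  open ≡-Reasoning
  bal′ : suc (downs s) ≡ ups s
  bal′ = trans bal (+-identityʳ (ups s))
  -- after a down step from height 1 nothing below height 0 can be deleted
  vanish : sumOverDowns (λ x → hStar 0 (hasUp x) * weight 0 x) s ≡ 0
  vanish = trans (sumOverDowns-factor (hStar 0) (weight 0) s)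
                 (cong (_* sumOverDowns (weight 0) s) (hStar-zero (hasUp s)))
weight-suc (suc zero) (true ∷ []) _ _ = refl
weight-suc (suc zero) (true ∷ b ∷ s) bal _ =
  weight-suc-down 0 (b ∷ s) (weight-suc 0 (b ∷ s) (suc-injective (trans bal (+-suc _ 0))) (s≤s z≤n))
weight-suc (suc (suc h)) (true ∷ s) bal _ =
  weight-suc-down (suc h) s (weight-suc (suc h) s (suc-injective (trans bal (+-suc _ (suc h)))) (s≤s z≤n))

-- insert a at position i (at the end when i exceeds the length)
ins : {A : Set} → ℕ → A → List A → List A
ins zero    a l       = a ∷ l
ins (suc i) a []      = a ∷ []
ins (suc i) a (b ∷ l) = b ∷ ins i a l

del : {A : Set} → ℕ → List A → List A
del i       []      = []
del zero    (b ∷ l) = l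
del (suc i) (b ∷ l) = b ∷ del i l

length-ins : {A : Set} → ∀ i (a : A) l → length (ins i a l) ≡ suc (length l)
length-ins zero    a l       = refl
length-ins (suc i) a []      = refl
length-ins (suc i) a (b ∷ l) = cong suc (length-ins i a l)

map-ins : {A B : Set} (f : A → B) → ∀ i a l → map f (ins i a l) ≡ ins i (f a) (map f l)
map-ins f zero    a l       = refl
map-ins f (suc i) a []      = refl
map-ins f (suc i) a (b ∷ l) = cong (f b ∷_) (map-ins f i a l)

module _ {m : ℕ} where

  _==_ : Fin m → Fin m → Bool
  x == y = does (x FinP.≟ y)

  ==-refl : ∀ x → (x == x) ≡ true
  ==-refl x = dec-true (x FinP.≟ x) refl

  ==-≢ : ∀ x y → x ≢ y → (x == y) ≡ false
  ==-≢ x y x≢y = dec-false (x FinP.≟ y) x≢y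

  ==-sym : ∀ x y → (x == y) ≡ (y == x)
  ==-sym x y with x FinP.≟ y | y FinP.≟ x
  ... | yes _   | yes _   = refl
  ... | no _    | no _    = refl
  ... | yes x≡y | no y≢x  = ⊥-elim (y≢x (sym x≡y))
  ... | no x≢y  | yes y≡x = ⊥-elim (x≢y (sym y≡x))

  _∈ᵇ_ : Fin m → List (Fin m) → Bool
  x ∈ᵇ []      = false
  x ∈ᵇ (y ∷ t) = (y == x) ∨ (x ∈ᵇ t)

  distinct : List (Fin m) → Bool
  distinct []      = true
  distinct (x ∷ t) = not (x ∈ᵇ t) ∧ distinct t

  allIn : (Fin m → Bool) → List (Fin m) → Bool
  allIn V []      = true
  allIn V (x ∷ t) = V x ∧ allIn V t

  _∖_ : (Fin m → Bool) → Fin m → (Fin m → Bool)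
  (V ∖ x) y = V y ∧ not (y == x)

  injectiveIn : (Fin m → Bool) → List (Fin m) → Bool
  injectiveIn V t = distinct t ∧ allIn V t

  ∖-elim : ∀ V (x y : Fin m) → (V ∖ x) y ≡ true → (V y ≡ true) × (y ≢ x)
  ∖-elim V x y e with V y | y FinP.≟ x
  ... | true  | no y≢x = refl , y≢x
  ... | true  | yes _  = ⊥-elim (true≢false (sym e))
  ... | false | _      = ⊥-elim (true≢false (sym e))

  ∖-intro : ∀ V (x y : Fin m) → V y ≡ true → y ≢ x → (V ∖ x) y ≡ true
  ∖-intro V x y Vy y≢x rewrite Vy | ==-≢ y x y≢x = refl

  ∖-self : ∀ V (x : Fin m) → (V ∖ x) x ≡ false
  ∖-self V x rewrite ==-refl x = BoolP.∧-zeroʳ (V x)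

  allIn⇒All : ∀ (P : Fin m → Bool) {Q : Fin m → Set} t → allIn P t ≡ true → (∀ z → P z ≡ true → Q z) → All Q t
  allIn⇒All P []      e h = []
  allIn⇒All P (z ∷ t) e h = h z (∧-trueˡ e) ∷ allIn⇒All P t (∧-trueʳ {P z} e) h

  allIn-∖ : ∀ V x t → allIn (V ∖ x) t ≡ allIn V t ∧ not (x ∈ᵇ t)
  allIn-∖ V x [] = refl
  allIn-∖ V x (y ∷ t) with V y | y == x
  ... | false | _     = refl
  ... | true  | true  = sym (BoolP.∧-zeroʳ (allIn V t))
  ... | true  | false = allIn-∖ V x t

  injectiveIn-cons : ∀ V x t → injectiveIn V (x ∷ t) ≡ V x ∧ injectiveIn (V ∖ x) t
  injectiveIn-cons V x t rewrite allIn-∖ V x t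
    with V x | x ∈ᵇ t | distinct t | allIn V t
  ... | false | _     | d     | a     = BoolP.∧-zeroʳ _
  ... | true  | true  | d     | a     = sym (trans (cong (d ∧_) (BoolP.∧-zeroʳ a)) (BoolP.∧-zeroʳ d))
  ... | true  | false | d     | a     = cong (d ∧_) (sym (BoolP.∧-identityʳ a))

  ∈ᵇ-ins : ∀ x i v l → x ∈ᵇ ins i v l ≡ (v == x) ∨ (x ∈ᵇ l)
  ∈ᵇ-ins x zero    v l       = refl
  ∈ᵇ-ins x (suc i) v []      = refl
  ∈ᵇ-ins x (suc i) v (b ∷ l) rewrite ∈ᵇ-ins x i v l with b == x | v == x
  ... | true  | true  = refl
  ... | true  | false = refl
  ... | false | _     = refl

  allIn-ins : ∀ V i v l → allIn V (ins i v l) ≡ V v ∧ allIn V l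
  allIn-ins V zero    v l       = refl
  allIn-ins V (suc i) v []      = refl
  allIn-ins V (suc i) v (b ∷ l) rewrite allIn-ins V i v l with V b | V v
  ... | true  | _     = refl
  ... | false | true  = refl
  ... | false | false = refl

  distinct-ins : ∀ i v l → distinct (ins i v l) ≡ not (v ∈ᵇ l) ∧ distinct l
  distinct-ins zero    v l       = refl
  distinct-ins (suc i) v []      = refl
  distinct-ins (suc i) v (b ∷ l) rewrite ∈ᵇ-ins b i v l | distinct-ins i v l | ==-sym v b
    with b == v | v ∈ᵇ l | b ∈ᵇ l | distinct l
  ... | true  | _     | _ | _ = refl
  ... | false | true  | _ | _ = BoolP.∧-zeroʳ _
  ... | false | false | _ | _ = refl

  injectiveIn-ins : ∀ W i v l → injectiveIn W (ins i v l) ≡ injectiveIn W (v ∷ l)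
  injectiveIn-ins W i v l rewrite distinct-ins i v l | allIn-ins W i v l = refl

  allIn-everything : ∀ t → allIn (λ _ → true) t ≡ true
  allIn-everything []      = refl
  allIn-everything (x ∷ t) = allIn-everything t

ΣFin : (m : ℕ) → (Fin m → ℕ) → ℕ
ΣFin zero    f = 0
ΣFin (suc m) f = f fzero + ΣFin m (f ∘ fsuc)

Σ< : ℕ → (ℕ → ℕ) → ℕ
Σ< zero    f = 0
Σ< (suc n) f = f 0 + Σ< n (f ∘ suc)

ΣList : {A : Set} → (A → ℕ) → List A → ℕ
ΣList f []       = 0
ΣList f (x ∷ xs) = f x + ΣList f xs

count : {A : Set} → (A → Bool) → List A → ℕ
count p []       = 0
count p (x ∷ xs) = ind (p x) + count p xs

words : (m k : ℕ) → List (List (Fin m))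
words m zero    = [] ∷ []
words m (suc k) = concatMap (λ x → map (x ∷_) (words m k)) (allFin m)

ΣFin-cong : ∀ m {f g : Fin m → ℕ} → (∀ i → f i ≡ g i) → ΣFin m f ≡ ΣFin m g
ΣFin-cong zero    e = refl
ΣFin-cong (suc m) e = cong₂ _+_ (e fzero) (ΣFin-cong m (e ∘ fsuc))

ΣFin-zero : ∀ m (f : Fin m → ℕ) → (∀ i → f i ≡ 0) → ΣFin m f ≡ 0
ΣFin-zero zero    f e = refl
ΣFin-zero (suc m) f e rewrite e fzero = ΣFin-zero m (f ∘ fsuc) (e ∘ fsuc)

ΣFin-+ : ∀ m (f g : Fin m → ℕ) → ΣFin m (λ i → f i + g i) ≡ ΣFin m f + ΣFin m g
ΣFin-+ zero    f g = refl
ΣFin-+ (suc m) f g rewrite ΣFin-+ m (f ∘ fsuc) (g ∘ fsuc) =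
  interchange (f fzero) (g fzero) (ΣFin m (f ∘ fsuc)) (ΣFin m (g ∘ fsuc))

ΣFin-*ʳ : ∀ m (f : Fin m → ℕ) c → ΣFin m (λ i → f i * c) ≡ ΣFin m f * c
ΣFin-*ʳ zero    f c = refl
ΣFin-*ʳ (suc m) f c rewrite ΣFin-*ʳ m (f ∘ fsuc) c = sym (*-distribʳ-+ c (f fzero) (ΣFin m (f ∘ fsuc)))

ΣFin-const-1 : ∀ m → ΣFin m (λ _ → 1) ≡ m
ΣFin-const-1 zero    = refl
ΣFin-const-1 (suc m) = cong suc (ΣFin-const-1 m)

ΣFin-point : ∀ m (v : Fin m) (f g : Fin m → ℕ) → (∀ i → i ≢ v → f i ≡ g i) → g v ≡ 0 →
  ΣFin m f ≡ f v + ΣFin m g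
ΣFin-point (suc m) fzero f g e gv rewrite gv =
  cong (f fzero +_) (ΣFin-cong m (λ i → e (fsuc i) (λ ())))
ΣFin-point (suc m) (fsuc v) f g e gv
  rewrite e fzero (λ ())
        | ΣFin-point m v (f ∘ fsuc) (g ∘ fsuc) (λ i i≢v → e (fsuc i) (i≢v ∘ FinP.suc-injective)) gv =
  trans (sym (+-assoc (g fzero) (f (fsuc v)) _))
        (trans (cong (_+ ΣFin m (g ∘ fsuc)) (+-comm (g fzero) (f (fsuc v)))) (+-assoc (f (fsuc v)) (g fzero) _))

Σ<-cong : ∀ n {f g : ℕ → ℕ} → (∀ i → i < n → f i ≡ g i) → Σ< n f ≡ Σ< n g
Σ<-cong zero    e = refl
Σ<-cong (suc n) e = cong₂ _+_ (e 0 (s≤s z≤n)) (Σ<-cong n (λ i i<n → e (suc i) (s≤s i<n)))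

Σ<-zero : ∀ n (f : ℕ → ℕ) → (∀ i → f i ≡ 0) → Σ< n f ≡ 0
Σ<-zero zero    f e = refl
Σ<-zero (suc n) f e rewrite e 0 = Σ<-zero n (f ∘ suc) (e ∘ suc)

ΣFin-Σ< : ∀ m n (F : ℕ → Fin m → ℕ) → ΣFin m (λ y → Σ< n (λ i → F i y)) ≡ Σ< n (λ i → ΣFin m (F i))
ΣFin-Σ< m zero    F = ΣFin-zero m _ (λ _ → refl)
ΣFin-Σ< m (suc n) F = trans (ΣFin-+ m (F 0) (λ y → Σ< n (λ i → F (suc i) y)))
                            (cong (ΣFin m (F 0) +_) (ΣFin-Σ< m n (F ∘ suc)))

count-++ : {A : Set} (p : A → Bool) → ∀ xs ys → count p (xs ++ ys) ≡ count p xs + count p ys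
count-++ p []       ys = refl
count-++ p (x ∷ xs) ys = trans (cong (ind (p x) +_) (count-++ p xs ys)) (sym (+-assoc (ind (p x)) _ _))

count-map : {A B : Set} (p : B → Bool) (f : A → B) → ∀ xs → count p (map f xs) ≡ count (p ∘ f) xs
count-map p f []       = refl
count-map p f (x ∷ xs) = cong (ind (p (f x)) +_) (count-map p f xs)

count-concatMap : {A B : Set} (p : B → Bool) (g : A → List B) → ∀ xs →
  count p (concatMap g xs) ≡ ΣList (λ x → count p (g x)) xs
count-concatMap p g []       = refl
count-concatMap p g (x ∷ xs) = trans (count-++ p (g x) _) (cong (count p (g x) +_) (count-concatMap p g xs))

ΣList-tabulate : {A : Set} (f : A → ℕ) → ∀ m (g : Fin m → A) → ΣList f (tabulate g) ≡ ΣFin m (f ∘ g)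
ΣList-tabulate f zero    g = refl
ΣList-tabulate f (suc m) g = cong (f (g fzero) +_) (ΣList-tabulate f m (g ∘ fsuc))

count-cong : {A : Set} (p q : A → Bool) → (∀ x → p x ≡ q x) → ∀ xs → count p xs ≡ count q xs
count-cong p q e []       = refl
count-cong p q e (x ∷ xs) = cong₂ _+_ (cong ind (e x)) (count-cong p q e xs)

count-∧ : {A : Set} (b : Bool) (p : A → Bool) → ∀ xs → count (λ t → b ∧ p t) xs ≡ ind b * count p xs
count-∧ true  p xs       = sym (+-identityʳ _)
count-∧ false p []       = refl
count-∧ false p (x ∷ xs) = count-∧ false p xs

count-words-suc : ∀ {m} k (p : List (Fin m) → Bool) →
  count p (words m (suc k)) ≡ ΣFin m (λ x → count (λ t → p (x ∷ t)) (words m k))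
count-words-suc {m} k p =
  trans (count-concatMap p _ (allFin m))
        (trans (ΣList-tabulate _ m id) (ΣFin-cong m (λ x → count-map p (x ∷_) (words m k))))

count-words-cong : ∀ {m} k (p q : List (Fin m) → Bool) → (∀ t → length t ≡ k → p t ≡ q t) →
  count p (words m k) ≡ count q (words m k)
count-words-cong zero p q e = cong (λ b → ind b + 0) (e [] refl)
count-words-cong {m} (suc k) p q e =
  trans (count-words-suc k p)
        (trans (ΣFin-cong m (λ x → count-words-cong k (λ t → p (x ∷ t)) (λ t → q (x ∷ t))
                                                     (λ t ∣t∣ → e (x ∷ t) (cong suc ∣t∣))))
               (sym (count-words-suc k q)))

count-words-none : ∀ {m} k (p : List (Fin m) → Bool) → (∀ t → length t ≡ k → p t ≡ false) →
  count p (words m k) ≡ 0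
count-words-none {m} k p e = trans (count-words-cong k p (λ _ → false) e) (none k)
  where
  none : ∀ k → count (λ _ → false) (words m k) ≡ 0
  none zero    = refl
  none (suc k) = trans (count-words-suc {m} k (λ _ → false)) (ΣFin-zero m _ (λ _ → none k))

-- Two facts drive the count: if the smallest
-- letter v comes first,  t = v y t′  gets marks  B A (marks t′); otherwise
-- t = x (t″ with v inserted at position i) gets marks  A (marks t″ with B
-- inserted at position i).

<ᵇ-true : ∀ a b → a < b → (a <ᵇ b) ≡ true
<ᵇ-true a b a<b = dec-true (a <? b) a<b

<ᵇ-false : ∀ a b → b ≤ a → (a <ᵇ b) ≡ false
<ᵇ-false a b b≤a = dec-false (a <? b) (≤⇒≯ b≤a)

module _ {m : ℕ} where

  argmin-first : ∀ (x : Fin m) l → All (λ z → toℕ x < toℕ z) l → argmin toℕ x l ≡ x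
  argmin-first x []      _          = refl
  argmin-first x (y ∷ l) (x<y ∷ ps) rewrite <ᵇ-false (toℕ y) (toℕ x) (<⇒≤ x<y) = argmin-first x l ps

  argmin-ins : ∀ (v acc : Fin m) i l → toℕ v < toℕ acc → All (λ z → toℕ v < toℕ z) l →
    argmin toℕ acc (ins i v l) ≡ v
  argmin-ins v acc zero    l       v<acc ps rewrite <ᵇ-true (toℕ v) (toℕ acc) v<acc = argmin-first v l ps
  argmin-ins v acc (suc i) []      v<acc ps rewrite <ᵇ-true (toℕ v) (toℕ acc) v<acc = refl
  argmin-ins v acc (suc i) (b ∷ l) v<acc (v<b ∷ ps) with toℕ b <ᵇ toℕ acc
  ... | true  = argmin-ins v b i l v<b ps
  ... | false = argmin-ins v acc i l v<acc ps

  argmin-∈ : ∀ (val : Fin m → ℕ) x l → argmin val x l ∈ᵇ (x ∷ l) ≡ true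
  argmin-∈ val x [] rewrite ==-refl x = refl
  argmin-∈ val x (y ∷ l) with val y <ᵇ val x | argmin-∈ val y l | argmin-∈ val x l
  ... | true  | ih | _ rewrite ih = BoolP.∨-zeroʳ (x == argmin val y l)
  ... | false | _ | ih with x == argmin val x l
  ...   | true  = refl
  ...   | false = trans (cong ((y == argmin val x l) ∨_) ih) (BoolP.∨-zeroʳ _)

  remove-∉ : ∀ (b : Fin m) l → b ∈ᵇ l ≡ false → remove b l ≡ l
  remove-∉ b []      _ = refl
  remove-∉ b (y ∷ l) e with y FinP.≟ b
  ... | yes _ = ⊥-elim (true≢false e)
  ... | no _  = cong (y ∷_) (remove-∉ b l e)

  remove-head : ∀ (b : Fin m) l → b ∈ᵇ l ≡ false → remove b (b ∷ l) ≡ l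
  remove-head b l e with b FinP.≟ b
  ... | yes _  = remove-∉ b l e
  ... | no b≢b = ⊥-elim (b≢b refl)

  remove-other : ∀ (b x : Fin m) l → x ≢ b → remove b (x ∷ l) ≡ x ∷ remove b l
  remove-other b x l x≢b with x FinP.≟ b
  ... | yes x≡b = ⊥-elim (x≢b x≡b)
  ... | no _    = refl

  remove-ins : ∀ (v : Fin m) i l → v ∈ᵇ l ≡ false → remove v (ins i v l) ≡ l
  remove-ins v zero    l       e = remove-head v l e
  remove-ins v (suc i) []      e = remove-head v [] e
  remove-ins v (suc i) (b ∷ l) e with b FinP.≟ v
  ... | yes _ = ⊥-elim (true≢false e)
  ... | no _  = cong (b ∷_) (remove-ins v i l e)

  ∉-remove : ∀ (z b : Fin m) l → z ∈ᵇ l ≡ false → z ∈ᵇ remove b l ≡ false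
  ∉-remove z b []      e = refl
  ∉-remove z b (y ∷ l) e with y FinP.≟ b
  ... | yes _ = ∉-remove z b l (∨-falseʳ e)
  ... | no _  = cong₂ _∨_ (∨-falseˡ e) (∉-remove z b l (∨-falseʳ e))

  ∉-drop1 : ∀ (z : Fin m) l → z ∈ᵇ l ≡ false → z ∈ᵇ drop 1 l ≡ false
  ∉-drop1 z []      e = refl
  ∉-drop1 z (y ∷ l) e = ∨-falseʳ e

  ∉-≢ : ∀ (z b : Fin m) l → z ∈ᵇ l ≡ false → b ∈ᵇ l ≡ true → (b == z) ≡ false
  ∉-≢ z b l z∉l b∈l with b FinP.≟ z
  ... | yes refl = trans (sym b∈l) z∉l
  ... | no _     = refl

  ∉-crossout : ∀ f (val : Fin m → ℕ) (z : Fin m) l → z ∈ᵇ l ≡ false → z ∈ᵇ crossout f val l ≡ false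
  ∉-crossout zero    val z l       e = refl
  ∉-crossout (suc f) val z []      e = refl
  ∉-crossout (suc f) val z (x ∷ l) e =
    cong₂ _∨_ (∉-≢ z b (x ∷ l) e (argmin-∈ val x l))
              (∉-crossout f val z _ (∉-drop1 z (remove b (x ∷ l)) (∉-remove z b (x ∷ l) e)))
    where
    b : Fin m
    b = argmin val x l

  -- each round removes at least one letter, so any fuel ≥ length suffices
  length-round : ∀ b (x : Fin m) l → length (drop 1 (remove b (x ∷ l))) ≤ length l
  length-round b x l rewrite LP.length-drop 1 (remove b (x ∷ l)) =
    ∸-monoˡ-≤ 1 (LP.length-filter (λ y → ¬? (y FinP.≟ b)) (x ∷ l))

  crossout-fuel : ∀ f g (val : Fin m → ℕ) l → length l ≤ f → length l ≤ g →
    crossout f val l ≡ crossout g val l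
  crossout-fuel zero    zero    val l       _ _ = refl
  crossout-fuel zero    (suc g) val []      _ _ = refl
  crossout-fuel (suc f) zero    val []      _ _ = refl
  crossout-fuel (suc f) (suc g) val []      _ _ = refl
  crossout-fuel (suc f) (suc g) val (x ∷ l) (s≤s l≤f) (s≤s l≤g) =
    cong (argmin val x l ∷_) (crossout-fuel f g val _ (≤-trans (length-round _ x l) l≤f)
                                                      (≤-trans (length-round _ x l) l≤g))

  bLetters : List (Fin m) → List (Fin m)
  bLetters t = crossout (length t) toℕ t

  marks : List (Fin m) → List Bool
  marks t = map (_∈ᵇ bLetters t) t

  map-cong-∈ᵇ : {B : Set} (f g : Fin m → B) → ∀ l → (∀ u → u ∈ᵇ l ≡ true → f u ≡ g u) → map f l ≡ map g l
  map-cong-∈ᵇ f g []      h = refl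
  map-cong-∈ᵇ f g (y ∷ l) h =
    cong₂ _∷_ (h y (cong (_∨ (y ∈ᵇ l)) (==-refl y))) (map-cong-∈ᵇ f g l (λ u u∈l → h u (later u∈l)))
    where
    later : ∀ {u} → u ∈ᵇ l ≡ true → (y == u) ∨ (u ∈ᵇ l) ≡ true
    later u∈l rewrite u∈l = BoolP.∨-zeroʳ _

  marks-extra : ∀ (x : Fin m) t → x ∈ᵇ t ≡ false →
    map (λ u → (x == u) ∨ (u ∈ᵇ bLetters t)) t ≡ marks t
  marks-extra x t x∉t = map-cong-∈ᵇ _ _ t
    (λ u u∈t → cong (_∨ (u ∈ᵇ bLetters t)) (trans (==-sym x u) (∉-≢ x u t x∉t u∈t)))

  bLetters-min-first : ∀ (x y : Fin m) t′ → All (λ z → toℕ x < toℕ z) (y ∷ t′) → x ∈ᵇ (y ∷ t′) ≡ false →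
    bLetters (x ∷ y ∷ t′) ≡ x ∷ bLetters t′
  bLetters-min-first x y t′ x<rest x∉rest = begin
      argmin toℕ x (y ∷ t′) ∷ crossout (suc (length t′)) toℕ (drop 1 (remove (argmin toℕ x (y ∷ t′)) (x ∷ y ∷ t′)))
    ≡⟨ cong (λ b → b ∷ crossout (suc (length t′)) toℕ (drop 1 (remove b (x ∷ y ∷ t′))))
            (argmin-first x (y ∷ t′) x<rest) ⟩
      x ∷ crossout (suc (length t′)) toℕ (drop 1 (remove x (x ∷ y ∷ t′)))
    ≡⟨ cong (λ r → x ∷ crossout (suc (length t′)) toℕ (drop 1 r)) (remove-head x (y ∷ t′) x∉rest) ⟩
      x ∷ crossout (suc (length t′)) toℕ t′
    ≡⟨ cong (x ∷_) (crossout-fuel (suc (length t′)) (length t′) toℕ t′ (n≤1+n _) ≤-refl) ⟩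
      x ∷ bLetters t′ ∎
    where open ≡-Reasoning

  marks-min-first : ∀ (x y : Fin m) t′ → All (λ z → toℕ x < toℕ z) (y ∷ t′) → distinct (x ∷ y ∷ t′) ≡ true →
    marks (x ∷ y ∷ t′) ≡ true ∷ false ∷ marks t′
  marks-min-first x y t′ x<rest d =
    trans (cong (λ c → map (_∈ᵇ c) (x ∷ y ∷ t′)) (bLetters-min-first x y t′ x<rest x∉rest))
      (cong₂ _∷_ (cong (_∨ (x ∈ᵇ bLetters t′)) (==-refl x))
        (cong₂ _∷_ (cong₂ _∨_ (trans (==-sym x y) (∨-falseˡ x∉rest)) (∉-crossout (length t′) toℕ y t′ y∉t′))
                   (marks-extra x t′ (∨-falseʳ x∉rest))))
    where
    x∉rest : (y == x) ∨ (x ∈ᵇ t′) ≡ false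
    x∉rest = not-true (∧-trueˡ d)
    y∉t′ : y ∈ᵇ t′ ≡ false
    y∉t′ = not-true (∧-trueˡ {not (y ∈ᵇ t′)} {distinct t′} (∧-trueʳ {not (x ∈ᵇ (y ∷ t′))} d))

  bLetters-min-later : ∀ (x v : Fin m) i t″ → toℕ v < toℕ x → All (λ z → toℕ v < toℕ z) t″ →
    v ∈ᵇ t″ ≡ false →
    bLetters (x ∷ ins i v t″) ≡ v ∷ bLetters t″
  bLetters-min-later x v i t″ v<x v<rest v∉t″ = begin
      argmin toℕ x (ins i v t″) ∷ crossout L toℕ (drop 1 (remove (argmin toℕ x (ins i v t″)) (x ∷ ins i v t″)))
    ≡⟨ cong (λ b → b ∷ crossout L toℕ (drop 1 (remove b (x ∷ ins i v t″)))) (argmin-ins v x i t″ v<x v<rest) ⟩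
      v ∷ crossout L toℕ (drop 1 (remove v (x ∷ ins i v t″)))
    ≡⟨ cong (λ r → v ∷ crossout L toℕ (drop 1 r))
            (trans (remove-other v x _ x≢v) (cong (x ∷_) (remove-ins v i t″ v∉t″))) ⟩
      v ∷ crossout L toℕ t″
    ≡⟨ cong (v ∷_) (crossout-fuel L (length t″) toℕ t″
                      (subst (length t″ ≤_) (sym (length-ins i v t″)) (n≤1+n _)) ≤-refl) ⟩
      v ∷ bLetters t″ ∎
    where
    open ≡-Reasoning
    L : ℕ
    L = length (ins i v t″)
    x≢v : x ≢ v
    x≢v x≡v = <-irrefl (cong toℕ (sym x≡v)) v<x

  marks-min-later : ∀ (x v : Fin m) i t″ → toℕ v < toℕ x → All (λ z → toℕ v < toℕ z) t″ →
    distinct (x ∷ ins i v t″) ≡ true → marks (x ∷ ins i v t″) ≡ false ∷ ins i true (marks t″)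
  marks-min-later x v i t″ v<x v<rest d =
    trans (cong (λ c → map (_∈ᵇ c) (x ∷ ins i v t″)) (bLetters-min-later x v i t″ v<x v<rest v∉t″))
      (cong₂ _∷_ (cong₂ _∨_ (∨-falseˡ x∉) (∉-crossout (length t″) toℕ x t″ (∨-falseʳ x∉)))
        (trans (map-ins (λ u → (v == u) ∨ (u ∈ᵇ bLetters t″)) i v t″)
               (cong₂ (ins i) (cong (_∨ (v ∈ᵇ bLetters t″)) (==-refl v)) (marks-extra v t″ v∉t″))))
    where
    d′ : not (x ∈ᵇ ins i v t″) ∧ distinct (ins i v t″) ≡ true
    d′ = d
    x∉ : (v == x) ∨ (x ∈ᵇ t″) ≡ false
    x∉ = trans (sym (∈ᵇ-ins x i v t″)) (not-true (∧-trueˡ d′))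
    v∉t″ : v ∈ᵇ t″ ≡ false
    v∉t″ = not-true (∧-trueˡ (trans (sym (distinct-ins i v t″)) (∧-trueʳ d′)))

module _ {m : ℕ} where

  count-by-position : ∀ j (v : Fin m) (q : List (Fin m) → Bool) →
    (∀ t → length t ≡ suc j → q t ≡ true → (v ∈ᵇ t ≡ true) × (distinct t ≡ true)) →
    count q (words m (suc j)) ≡ Σ< (suc j) (λ i → count (λ t → q (ins i v t)) (words m j))
  count-by-position zero v q hyp =
    trans (count-words-suc 0 q)
          (trans (ΣFin-point m v (λ y → ind (q (y ∷ [])) + 0) (λ _ → 0) elsewhere refl)
                 (cong (ind (q (v ∷ [])) + 0 +_) (ΣFin-zero m (λ _ → 0) (λ _ → refl))))
    where
    elsewhere : ∀ y → y ≢ v → ind (q (y ∷ [])) + 0 ≡ 0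
    elsewhere y y≢v with q (y ∷ []) in qy
    ... | false = refl
    ... | true  = ⊥-elim (true≢false (trans (sym (proj₁ (hyp (y ∷ []) refl qy)))
                                            (cong (_∨ false) (==-≢ y v y≢v))))
  count-by-position (suc j) v q hyp = begin
      count q (words m (suc (suc j)))
    ≡⟨ count-words-suc (suc j) q ⟩
      ΣFin m X
    ≡⟨ ΣFin-point m v X Y elsewhere Yv ⟩
      X v + ΣFin m Y
    ≡⟨ cong (X v +_) (ΣFin-Σ< m (suc j) F) ⟩
      X v + Σ< (suc j) (λ i → ΣFin m (F i))
    ≡⟨ cong (X v +_) (Σ<-cong (suc j) (λ i _ → sym (count-words-suc j (λ t → q (ins (suc i) v t))))) ⟩
      X v + Σ< (suc j) (λ i → count (λ t → q (ins (suc i) v t)) (words m (suc j))) ∎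
    where
    open ≡-Reasoning
    X : Fin m → ℕ
    X y = count (λ t → q (y ∷ t)) (words m (suc j))
    F : ℕ → Fin m → ℕ
    F i y = count (λ t → q (y ∷ ins i v t)) (words m j)
    Y : Fin m → ℕ
    Y y = Σ< (suc j) (λ i → F i y)
    elsewhere : ∀ y → y ≢ v → X y ≡ Y y
    elsewhere y y≢v = count-by-position j v (λ t → q (y ∷ t)) hyp′
      where
      hyp′ : ∀ t → length t ≡ suc j → q (y ∷ t) ≡ true → (v ∈ᵇ t ≡ true) × (distinct t ≡ true)
      hyp′ t ∣t∣ qyt with hyp (y ∷ t) (cong suc ∣t∣) qyt
      ... | v∈ , d = trans (sym (cong (_∨ (v ∈ᵇ t)) (==-≢ y v y≢v))) v∈ , ∧-trueʳ d
    -- a word cannot contain v twice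
    Yv : Y v ≡ 0
    Yv = Σ<-zero (suc j) _ (λ i → count-words-none j _ (twice i))
      where
      twice : ∀ i t → length t ≡ j → q (v ∷ ins i v t) ≡ false
      twice i t ∣t∣ with q (v ∷ ins i v t) in qt
      ... | false = refl
      ... | true  = ⊥-elim (true≢false (trans (sym (trans (∈ᵇ-ins v i v t) (cong (_∨ (v ∈ᵇ t)) (==-refl v))))
                      (not-true (∧-trueˡ (proj₂ (hyp (v ∷ ins i v t)
                                   (cong suc (trans (length-ins i v t) (cong suc ∣t∣))) qt))))))

  size : (Fin m → Bool) → ℕ
  size V = ΣFin m (ind ∘ V)

  size-∖ : ∀ V x → V x ≡ true → suc (size (V ∖ x)) ≡ size V
  size-∖ V x Vx = sym (trans (ΣFin-point m x (ind ∘ V) (ind ∘ (V ∖ x)) elsewhere at-x)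
                             (cong (_+ size (V ∖ x)) (cong ind Vx)))
    where
    elsewhere : ∀ i → i ≢ x → ind (V i) ≡ ind (V i ∧ not (i == x))
    elsewhere i i≢x rewrite ==-≢ i x i≢x | BoolP.∧-identityʳ (V i) = refl
    at-x : ind (V x ∧ not (x == x)) ≡ 0
    at-x rewrite ==-refl x | BoolP.∧-zeroʳ (V x) = refl

  length-injectiveIn : ∀ V t → injectiveIn V t ≡ true → length t ≤ size V
  length-injectiveIn V []      _ = z≤n
  length-injectiveIn V (x ∷ t) e =
    subst (suc (length t) ≤_) (size-∖ V x (∧-trueˡ e′)) (s≤s (length-injectiveIn (V ∖ x) t (∧-trueʳ {V x} e′)))
    where
    e′ : V x ∧ injectiveIn (V ∖ x) t ≡ true
    e′ = trans (sym (injectiveIn-cons V x t)) e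

  injectiveIn-full : ∀ V t u → injectiveIn V t ≡ true → length t ≡ size V → V u ≡ true → u ∈ᵇ t ≡ true
  injectiveIn-full V t u inj ∣t∣ Vu with u ∈ᵇ t in u∈t
  ... | true  = refl
  ... | false = ⊥-elim (<-irrefl refl (≤-trans (s≤s (length-injectiveIn (V ∖ u) t inj′))
                                              (≤-reflexive (trans (size-∖ V u Vu) (sym ∣t∣)))))
    where
    inj′ : injectiveIn (V ∖ u) t ≡ true
    inj′ rewrite allIn-∖ V u t | u∈t | BoolP.∧-identityʳ (allIn V t) = inj

minimum : ∀ {m} (V : Fin m → Bool) → 1 ≤ size V →
  Σ (Fin m) λ v → (V v ≡ true) × (∀ y → V y ≡ true → toℕ v ≤ toℕ y)
minimum {suc m} V nonempty with V fzero in V0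
... | true  = fzero , V0 , (λ _ _ → z≤n)
... | false with minimum (V ∘ fsuc) nonempty
...   | v , Vv , least = fsuc v , Vv , least′
  where
  least′ : ∀ y → V y ≡ true → toℕ (fsuc v) ≤ toℕ y
  least′ fzero    Vy = ⊥-elim (true≢false (trans (sym Vy) V0))
  least′ (fsuc y) Vy = s≤s (least y Vy)

boolEq : Bool → Bool → Bool
boolEq true  b = b
boolEq false b = not b

listEq : List Bool → List Bool → Bool
listEq []      []       = true
listEq []      (_ ∷ _)  = false
listEq (_ ∷ _) []       = false
listEq (a ∷ l) (b ∷ l′) = boolEq a b ∧ listEq l l′

listEq-sound : ∀ a b → listEq a b ≡ true → a ≡ b
listEq-sound []          []          _ = refl
listEq-sound (true ∷ a)  (true ∷ b)  e = cong (true ∷_) (listEq-sound a b e)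
listEq-sound (false ∷ a) (false ∷ b) e = cong (false ∷_) (listEq-sound a b e)

listEq-refl : ∀ a → listEq a a ≡ true
listEq-refl []          = refl
listEq-refl (true ∷ a)  = listEq-refl a
listEq-refl (false ∷ a) = listEq-refl a

-- the entry at position i (false when out of range)
nth : List Bool → ℕ → Bool
nth []      _       = false
nth (b ∷ l) zero    = b
nth (b ∷ l) (suc i) = nth l i

listEq-ins : ∀ i c u → length u ≡ suc (length c) → i ≤ length c →
  listEq (ins i true c) u ≡ nth u i ∧ listEq c (del i u)
listEq-ins zero c (true ∷ u)  _ _ = refl
listEq-ins zero c (false ∷ u) _ _ = refl
listEq-ins (suc i) (a ∷ c) (b ∷ u) ∣u∣ (s≤s i≤c)
  rewrite listEq-ins i c u (suc-injective ∣u∣) i≤c with boolEq a b | nth u i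
... | true  | _     = refl
... | false | true  = refl
... | false | false = refl

sumOverDowns-Σ< : ∀ u (G : List Bool → ℕ) → Σ< (length u) (λ i → ind (nth u i) * G (del i u)) ≡ sumOverDowns G u
sumOverDowns-Σ< []          G = refl
sumOverDowns-Σ< (true ∷ u)  G = cong₂ _+_ (+-identityʳ _) (sumOverDowns-Σ< u (λ x → G (true ∷ x)))
sumOverDowns-Σ< (false ∷ u) G = sumOverDowns-Σ< u (λ x → G (false ∷ x))

del-down : ∀ i u → nth u i ≡ true →
  (suc (length (del i u)) ≡ length u) × (suc (downs (del i u)) ≡ downs u) × (ups (del i u) ≡ ups u)
del-down zero    (true ∷ u) _ = refl , refl , refl
del-down (suc i) (b ∷ u)    e with del-down i u e
... | ∣u∣ , d , a = cong suc ∣u∣ , trans (sym (+-suc (ind b) _)) (cong (ind b +_) d) , cong (ind (not b) +_) a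

-- 2j, with the recursion  double (j+1) = double j + 2  built in
double : ℕ → ℕ
double zero    = 0
double (suc j) = suc (suc (double j))

double≡2* : ∀ j → double j ≡ 2 * j
double≡2* zero    = refl
double≡2* (suc j) = cong suc (trans (cong suc (double≡2* j)) (sym (+-suc j (j + 0))))

module _ {m : ℕ} where

  valid : (Fin m → Bool) → List Bool → List (Fin m) → Bool
  valid V s t = injectiveIn V t ∧ listEq (marks t) s

  CountFormula : ℕ → Set
  CountFormula j = ∀ (V : Fin m → Bool) s → size V ≡ double j → length s ≡ double j → downs s ≡ ups s →
    count (valid V s) (words m (double j)) ≡ oddProd j * weight 1 s

  module InductionStep (j : ℕ) (IH : CountFormula j) (V : Fin m → Bool) (∣V∣ : size V ≡ suc (suc (double j)))
                       (v : Fin m) (Vv : V v ≡ true) (v-least : ∀ y → V y ≡ true → toℕ v ≤ toℕ y) where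
    k : ℕ
    k = double j
    o : ℕ
    o = oddProd j

    v-below : ∀ z → V z ≡ true → z ≢ v → toℕ v < toℕ z
    v-below z Vz z≢v = ≤∧≢⇒< (v-least z Vz) (λ e → z≢v (sym (FinP.toℕ-injective e)))

    size-∖′ : ∀ x → V x ≡ true → size (V ∖ x) ≡ suc k
    size-∖′ x Vx = suc-injective (trans (size-∖ V x Vx) ∣V∣)

    countLeastFirst : List Bool → ℕ
    countLeastFirst (true ∷ false ∷ s″) = suc k * (o * weight 1 s″)
    countLeastFirst _                   = 0

    countOtherFirst : List Bool → ℕ
    countOtherFirst (false ∷ u) = o * weight 2 u
    countOtherFirst _           = 0

    valid-least-first : ∀ s y t′ → valid V s (v ∷ y ∷ t′) ≡
      (V ∖ v) y ∧ (injectiveIn ((V ∖ v) ∖ y) t′ ∧ listEq (true ∷ false ∷ marks t′) s)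
    valid-least-first s y t′ =
      trans (cong (_∧ listEq (marks (v ∷ y ∷ t′)) s)
                  (trans (injectiveIn-cons V v (y ∷ t′)) (cong₂ _∧_ Vv (injectiveIn-cons (V ∖ v) y t′))))
            (by-cases refl)
      where
      by-cases : ∀ {b} → (V ∖ v) y ∧ injectiveIn ((V ∖ v) ∖ y) t′ ≡ b →
        b ∧ listEq (marks (v ∷ y ∷ t′)) s
          ≡ (V ∖ v) y ∧ (injectiveIn ((V ∖ v) ∖ y) t′ ∧ listEq (true ∷ false ∷ marks t′) s)
      by-cases {false} e with (V ∖ v) y | injectiveIn ((V ∖ v) ∖ y) t′
      ... | false | _     = refl
      ... | true  | false = refl
      by-cases {true} e rewrite ∧-trueˡ {(V ∖ v) y} e | ∧-trueʳ {(V ∖ v) y} e =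
        cong (λ c → listEq c s) (marks-min-first v y t′ above distinct-vyt′)
        where
        y∈V∖v : (V ∖ v) y ≡ true
        y∈V∖v = ∧-trueˡ e
        above : All (λ z → toℕ v < toℕ z) (y ∷ t′)
        above = v-below y (proj₁ (∖-elim V v y y∈V∖v)) (proj₂ (∖-elim V v y y∈V∖v)) ∷
          allIn⇒All ((V ∖ v) ∖ y) t′ (∧-trueʳ {distinct t′} (∧-trueʳ {(V ∖ v) y} e))
            (λ z Wz → let z∈V∖v , _ = ∖-elim (V ∖ v) y z Wz; Vz , z≢v = ∖-elim V v z z∈V∖v in v-below z Vz z≢v)
        distinct-vyt′ : distinct (v ∷ y ∷ t′) ≡ true
        distinct-vyt′ = ∧-trueˡ (trans (injectiveIn-cons V v (y ∷ t′))
                                       (cong₂ _∧_ Vv (trans (injectiveIn-cons (V ∖ v) y t′) e)))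

    ΣFin-count-none : ∀ (F : Fin m → List (Fin m) → Bool) (c : Fin m → ℕ) →
      (∀ y t → length t ≡ k → F y t ≡ false) →
      ΣFin m (λ y → c y * count (F y) (words m k)) ≡ 0
    ΣFin-count-none F c none =
      ΣFin-zero m _ (λ y → trans (cong (c y *_) (count-words-none k (F y) (none y))) (*-zeroʳ (c y)))

    -- Words starting with v: the pattern must begin with B A, and then the
    -- second letter y is any of the 2j+1 letters of V ∖ v and the rest is
    -- counted by the induction hypothesis.
    count-least-first : ∀ s → length s ≡ suc (suc k) → downs s ≡ ups s →
      count (λ t → valid V s (v ∷ t)) (words m (suc k)) ≡ countLeastFirst s
    count-least-first s ∣s∣ bal =
      trans (count-words-suc k (λ t → valid V s (v ∷ t)))
            (trans (ΣFin-cong m (λ y → trans (count-words-cong k _ _ (λ t′ _ → valid-least-first s y t′))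
                                             (count-∧ ((V ∖ v) y) _ (words m k))))
                   (by-pattern s ∣s∣ bal))
      where
      by-pattern : ∀ s → length s ≡ suc (suc k) → downs s ≡ ups s →
        ΣFin m (λ y → ind ((V ∖ v) y) *
                      count (λ t′ → injectiveIn ((V ∖ v) ∖ y) t′ ∧ listEq (true ∷ false ∷ marks t′) s) (words m k))
          ≡ countLeastFirst s
      by-pattern (true ∷ false ∷ s″) ∣s∣ bal =
        trans (ΣFin-cong m per-letter)
              (trans (ΣFin-*ʳ m (ind ∘ (V ∖ v)) _) (cong (_* (o * weight 1 s″)) (size-∖′ v Vv)))
        where
        per-letter : ∀ y → ind ((V ∖ v) y) * count (valid ((V ∖ v) ∖ y) s″) (words m k)
                         ≡ ind ((V ∖ v) y) * (o * weight 1 s″)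
        per-letter y with (V ∖ v) y in Vy
        ... | false = refl
        ... | true  = cong (1 *_) (IH ((V ∖ v) ∖ y) s″ (suc-injective (trans (size-∖ (V ∖ v) y Vy) (size-∖′ v Vv)))
                                     (suc-injective (suc-injective ∣s∣)) (suc-injective bal))
      by-pattern (true ∷ true ∷ s″) _ _ = ΣFin-count-none _ (ind ∘ (V ∖ v)) (λ y t _ → BoolP.∧-zeroʳ _)
      by-pattern (false ∷ u)        _ _ = ΣFin-count-none _ (ind ∘ (V ∖ v)) (λ y t _ → BoolP.∧-zeroʳ _)

    valid-other-first : ∀ s x → V x ≡ true → x ≢ v → ∀ i t →
      valid V s (x ∷ ins i v t) ≡ injectiveIn ((V ∖ x) ∖ v) t ∧ listEq (false ∷ ins i true (marks t)) s
    valid-other-first s x Vx x≢v i t = trans (cong (_∧ listEq (marks (x ∷ ins i v t)) s) injective≡) (by-cases refl)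
      where
      injective≡ : injectiveIn V (x ∷ ins i v t) ≡ injectiveIn ((V ∖ x) ∖ v) t
      injective≡ =
        trans (injectiveIn-cons V x (ins i v t))
              (trans (cong₂ _∧_ Vx (trans (injectiveIn-ins (V ∖ x) i v t) (injectiveIn-cons (V ∖ x) v t)))
                     (cong (_∧ injectiveIn ((V ∖ x) ∖ v) t) (∖-intro V x v Vv (x≢v ∘ sym))))
      by-cases : ∀ {b} → injectiveIn ((V ∖ x) ∖ v) t ≡ b →
        injectiveIn ((V ∖ x) ∖ v) t ∧ listEq (marks (x ∷ ins i v t)) s
          ≡ injectiveIn ((V ∖ x) ∖ v) t ∧ listEq (false ∷ ins i true (marks t)) s
      by-cases {false} e rewrite e = refl
      by-cases {true}  e rewrite e = cong (λ c → listEq c s) (marks-min-later x v i t (v-below x Vx x≢v) above distinct-xt)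
        where
        above : All (λ z → toℕ v < toℕ z) t
        above = allIn⇒All ((V ∖ x) ∖ v) t (∧-trueʳ {distinct t} e)
          (λ z Wz → let z∈V∖x , z≢v = ∖-elim (V ∖ x) v z Wz; Vz , _ = ∖-elim V x z z∈V∖x in v-below z Vz z≢v)
        distinct-xt : distinct (x ∷ ins i v t) ≡ true
        distinct-xt = ∧-trueˡ (trans injective≡ e)

    -- Words starting with another letter x of V: by pigeonhole they contain v;
    -- with v at position i+1, the pattern must be A followed by the marks of
    -- the remaining word with a B inserted at i.  Summing over i gives a sum
    -- over the down steps of the pattern tail, i.e. weight 2 by weight-suc.
    count-other-first : ∀ s x → x ≢ v → length s ≡ suc (suc k) → downs s ≡ ups s →
      count (λ t → valid V s (x ∷ t)) (words m (suc k)) ≡ ind ((V ∖ v) x) * countOtherFirst s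
    count-other-first s x x≢v ∣s∣ bal = by-membership (V x) refl
      where
      by-membership : ∀ b → V x ≡ b →
        count (λ t → valid V s (x ∷ t)) (words m (suc k)) ≡ ind ((V ∖ v) x) * countOtherFirst s
      by-membership false Vx =
        trans (count-words-none (suc k) _
                (λ t _ → cong (_∧ listEq (marks (x ∷ t)) s)
                              (trans (injectiveIn-cons V x t) (cong (_∧ injectiveIn (V ∖ x) t) Vx))))
              (cong (λ b → ind (b ∧ not (x == v)) * countOtherFirst s) (sym Vx))
      by-membership true Vx =
        trans (count-by-position k v (λ t → valid V s (x ∷ t)) contains-v)
              (trans (by-pattern s ∣s∣ bal) (cong (λ b → ind b * countOtherFirst s) (sym (∖-intro V v x Vx x≢v))))
        where
        contains-v : ∀ t → length t ≡ suc k → valid V s (x ∷ t) ≡ true → (v ∈ᵇ t ≡ true) × (distinct t ≡ true)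
        contains-v t ∣t∣ e =
          injectiveIn-full (V ∖ x) t v inj (trans ∣t∣ (sym (size-∖′ x Vx))) (∖-intro V x v Vv (x≢v ∘ sym))
                           , ∧-trueˡ inj
          where
          inj : injectiveIn (V ∖ x) t ≡ true
          inj = ∧-trueʳ {V x} (trans (sym (injectiveIn-cons V x t)) (∧-trueˡ e))

        W : Fin m → Bool
        W = (V ∖ x) ∖ v

        ∣W∣ : size W ≡ k
        ∣W∣ = suc-injective (trans (size-∖ (V ∖ x) v (∖-intro V x v Vv (x≢v ∘ sym))) (size-∖′ x Vx))

        -- with v at position i, the words are counted by the induction
        -- hypothesis applied to the pattern tail u with its B at i deleted
        per-position : ∀ u → length u ≡ suc k → downs u ≡ suc (ups u) → ∀ i → i < suc k →
          count (λ t → valid V (false ∷ u) (x ∷ ins i v t)) (words m k) ≡ ind (nth u i) * (o * weight 1 (del i u))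
        per-position u ∣u∣ bal′ i (s≤s i≤k) =
          trans (count-words-cong k _ (λ t → nth u i ∧ valid W (del i u) t) split)
                (trans (count-∧ (nth u i) _ (words m k)) by-IH)
          where
          split : ∀ t → length t ≡ k → valid V (false ∷ u) (x ∷ ins i v t) ≡ nth u i ∧ valid W (del i u) t
          split t ∣t∣ = trans (valid-other-first (false ∷ u) x Vx x≢v i t)
            (trans (cong (injectiveIn W t ∧_)
                         (listEq-ins i (marks t) u (trans ∣u∣ (cong suc (sym ∣marks-t∣)))
                                     (subst (i ≤_) (sym ∣marks-t∣) i≤k)))
                   (∧-swap (injectiveIn W t) (nth u i) _))
            where
            ∣marks-t∣ : length (marks t) ≡ k
            ∣marks-t∣ = trans (LP.length-map _ t) ∣t∣
          by-IH : ind (nth u i) * count (valid W (del i u)) (words m k) ≡ ind (nth u i) * (o * weight 1 (del i u))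
          by-IH with nth u i in down
          ... | false = refl
          ... | true with del-down i u down
          ...   | ∣del∣ , d , a = cong (1 *_) (IH W (del i u) ∣W∣ (suc-injective (trans ∣del∣ ∣u∣))
                                                (trans (suc-injective (trans d bal′)) (sym a)))

        by-pattern : ∀ s → length s ≡ suc (suc k) → downs s ≡ ups s →
          Σ< (suc k) (λ i → count (λ t → valid V s (x ∷ ins i v t)) (words m k)) ≡ 1 * countOtherFirst s
        by-pattern (true ∷ u) _ _ =
          Σ<-zero (suc k) _ (λ i → count-words-none k _
            (λ t _ → trans (valid-other-first (true ∷ u) x Vx x≢v i t) (BoolP.∧-zeroʳ _)))
        by-pattern (false ∷ u) ∣s∣ bal = begin
            Σ< (suc k) (λ i → count (λ t → valid V (false ∷ u) (x ∷ ins i v t)) (words m k))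
          ≡⟨ Σ<-cong (suc k) (per-position u ∣u∣ bal) ⟩
            Σ< (suc k) (λ i → ind (nth u i) * (o * weight 1 (del i u)))
          ≡⟨ cong (λ n → Σ< n (λ i → ind (nth u i) * (o * weight 1 (del i u)))) (sym ∣u∣) ⟩
            Σ< (length u) (λ i → ind (nth u i) * (o * weight 1 (del i u)))
          ≡⟨ sumOverDowns-Σ< u (λ y → o * weight 1 y) ⟩
            sumOverDowns (λ y → o * weight 1 y) u
          ≡⟨ sumOverDowns-factor (λ _ → o) (weight 1) u ⟩
            o * sumOverDowns (weight 1) u
          ≡⟨ cong (o *_) (sym (weight-suc 1 u (trans bal (+-comm 1 (ups u))) (s≤s z≤n))) ⟩
            o * weight 2 u
          ≡⟨ sym (*-identityˡ _) ⟩
            1 * (o * weight 2 u) ∎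
          where
          open ≡-Reasoning
          ∣u∣ : length u ≡ suc k
          ∣u∣ = suc-injective ∣s∣

    step : ∀ s → length s ≡ double (suc j) → downs s ≡ ups s →
      count (valid V s) (words m (double (suc j))) ≡ oddProd (suc j) * weight 1 s
    step s ∣s∣ bal = begin
        count (valid V s) (words m (suc (suc k)))
      ≡⟨ count-words-suc (suc k) (valid V s) ⟩
        ΣFin m X
      ≡⟨ ΣFin-point m v X Z (λ x x≢v → count-other-first s x x≢v ∣s∣ bal) Zv ⟩
        X v + ΣFin m Z
      ≡⟨ cong₂ _+_ (count-least-first s ∣s∣ bal)
                   (trans (ΣFin-*ʳ m (ind ∘ (V ∖ v)) (countOtherFirst s)) (cong (_* countOtherFirst s) (size-∖′ v Vv))) ⟩
        countLeastFirst s + suc k * countOtherFirst s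
      ≡⟨ combine s ∣s∣ ⟩
        oddProd (suc j) * weight 1 s ∎
      where
      open ≡-Reasoning
      X : Fin m → ℕ
      X x = count (λ t → valid V s (x ∷ t)) (words m (suc k))
      Z : Fin m → ℕ
      Z x = ind ((V ∖ v) x) * countOtherFirst s
      Zv : Z v ≡ 0
      Zv = cong (λ b → ind b * countOtherFirst s) (∖-self V v)
      2j+1 : suc k ≡ 2 * j + 1
      2j+1 = trans (cong suc (double≡2* j)) (+-comm 1 (2 * j))
      combine : ∀ s → length s ≡ suc (suc k) → countLeastFirst s + suc k * countOtherFirst s ≡ oddProd (suc j) * weight 1 s
      combine (true ∷ false ∷ s″) _ = begin
          suc k * (o * weight 1 s″) + suc k * 0
        ≡⟨ cong₂ _+_ (sym (*-assoc (suc k) o _)) (*-zeroʳ (suc k)) ⟩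
          suc k * o * weight 1 s″ + 0
        ≡⟨ +-identityʳ _ ⟩
          suc k * o * weight 1 s″
        ≡⟨ cong₂ _*_ (cong (_* o) 2j+1) (sym (*-identityˡ _)) ⟩
          (2 * j + 1) * o * (1 * weight 1 s″) ∎
      combine (true ∷ true ∷ s″) _ =
        trans (*-zeroʳ (suc k)) (sym (trans (cong (oddProd (suc j) *_) (weight-down-down s″)) (*-zeroʳ (oddProd (suc j)))))
      combine (false ∷ u) _ = begin
          0 + suc k * (o * weight 2 u)
        ≡⟨ sym (*-assoc (suc k) o _) ⟩
          suc k * o * weight 2 u
        ≡⟨ cong (λ a → a * o * weight 2 u) 2j+1 ⟩
          (2 * j + 1) * o * weight 2 u ∎

  count-formula : ∀ j → CountFormula j
  count-formula zero    V [] _ _ _ = refl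
  count-formula (suc j) V s ∣V∣ ∣s∣ bal with minimum V (subst (1 ≤_) (sym ∣V∣) (s≤s z≤n))
  ... | v , Vv , v-least = InductionStep.step j (count-formula j) V ∣V∣ v Vv v-least s ∣s∣ bal

-- The crossout procedure only compares values, so applying an
-- injective relabelling g of the letters commutes with it.  This transports
-- the procedure of Defs (run on positions, compared by their values w(i))
-- to the procedure on the word of values itself.

module _ {M m : ℕ} (g : Fin M → Fin m) (g-injective : ∀ a b → g a ≡ g b → a ≡ b) where

  ==-relabel : ∀ y a → (g y == g a) ≡ (y == a)
  ==-relabel y a with y FinP.≟ a | g y FinP.≟ g a
  ... | yes _   | yes _    = refl
  ... | no _    | no _     = refl
  ... | yes y≡a | no gy≢ga = ⊥-elim (gy≢ga (cong g y≡a))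
  ... | no y≢a  | yes gy≡ga = ⊥-elim (y≢a (g-injective y a gy≡ga))

  argmin-relabel : ∀ x l → g (argmin (toℕ ∘ g) x l) ≡ argmin toℕ (g x) (map g l)
  argmin-relabel x []      = refl
  argmin-relabel x (y ∷ l) with toℕ (g y) <ᵇ toℕ (g x)
  ... | true  = argmin-relabel y l
  ... | false = argmin-relabel x l

  remove-relabel : ∀ b l → map g (remove b l) ≡ remove (g b) (map g l)
  remove-relabel b []      = refl
  remove-relabel b (y ∷ l) with y FinP.≟ b | g y FinP.≟ g b
  ... | yes _   | yes _     = remove-relabel b l
  ... | no _    | no _      = cong (g y ∷_) (remove-relabel b l)
  ... | yes y≡b | no gy≢gb  = ⊥-elim (gy≢gb (cong g y≡b))
  ... | no y≢b  | yes gy≡gb = ⊥-elim (y≢b (g-injective y b gy≡gb))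

  crossout-relabel : ∀ f l → map g (crossout f (toℕ ∘ g) l) ≡ crossout f toℕ (map g l)
  crossout-relabel zero    l       = refl
  crossout-relabel (suc f) []      = refl
  crossout-relabel (suc f) (x ∷ l) =
    cong₂ _∷_ (argmin-relabel x l)
      (trans (crossout-relabel f _)
        (cong (crossout f toℕ) (trans (sym (LP.drop-map 1 (remove b (x ∷ l))))
          (cong (drop 1) (trans (remove-relabel b (x ∷ l)) (cong (λ c → remove c (g x ∷ map g l)) (argmin-relabel x l)))))))
    where
    b : Fin M
    b = argmin (toℕ ∘ g) x l

  ∈ᵇ-relabel : ∀ a l → g a ∈ᵇ map g l ≡ a ∈ᵇ l
  ∈ᵇ-relabel a []      = refl
  ∈ᵇ-relabel a (y ∷ l) = cong₂ _∨_ (==-relabel y a) (∈ᵇ-relabel a l)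

module _ {m : ℕ} where

  ∉ᵇ⇒All≢ : ∀ (x : Fin m) xs → x ∈ᵇ xs ≡ false → All (x ≢_) xs
  ∉ᵇ⇒All≢ x []       _ = []
  ∉ᵇ⇒All≢ x (y ∷ xs) e =
    (λ x≡y → true≢false (trans (sym (cong (_∨ (x ∈ᵇ xs)) (trans (cong (y ==_) x≡y) (==-refl y)))) e))
                        ∷ ∉ᵇ⇒All≢ x xs (∨-falseʳ e)

  All≢⇒∉ᵇ : ∀ (x : Fin m) xs → All (x ≢_) xs → x ∈ᵇ xs ≡ false
  All≢⇒∉ᵇ x []       _          = refl
  All≢⇒∉ᵇ x (y ∷ xs) (x≢y ∷ ps) = cong₂ _∨_ (==-≢ y x (x≢y ∘ sym)) (All≢⇒∉ᵇ x xs ps)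

  Unique⇒distinct : ∀ (t : List (Fin m)) → Unique t → distinct t ≡ true
  Unique⇒distinct []      _        = refl
  Unique⇒distinct (x ∷ t) (p ∷ u) = cong₂ _∧_ (cong not (All≢⇒∉ᵇ x t p)) (Unique⇒distinct t u)

  distinct⇒Unique : ∀ (t : List (Fin m)) → distinct t ≡ true → Unique t
  distinct⇒Unique []      _ = []
  distinct⇒Unique (x ∷ t) e = ∉ᵇ⇒All≢ x t (not-true (∧-trueˡ e)) ∷ distinct⇒Unique t (∧-trueʳ {not (x ∈ᵇ t)} e)

  ∈ᵇ-tabulate : ∀ {N} (f : Fin N → Fin m) i → f i ∈ᵇ tabulate f ≡ true
  ∈ᵇ-tabulate f fzero    rewrite ==-refl (f fzero) = refl
  ∈ᵇ-tabulate f (fsuc i) rewrite ∈ᵇ-tabulate (f ∘ fsuc) i = BoolP.∨-zeroʳ (f fzero == f (fsuc i))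

  head-fresh : ∀ {N} (f : Fin (suc N) → Fin m) → distinct (tabulate f) ≡ true → ∀ b → f fzero ≢ f (fsuc b)
  head-fresh f d b e = true≢false
    (trans (sym (trans (cong (_∈ᵇ tabulate (f ∘ fsuc)) e) (∈ᵇ-tabulate (f ∘ fsuc) b))) (not-true (∧-trueˡ d)))

  distinct⇒injective : ∀ {N} (f : Fin N → Fin m) → distinct (tabulate f) ≡ true → ∀ a b → f a ≡ f b → a ≡ b
  distinct⇒injective f d fzero    fzero    e = refl
  distinct⇒injective f d fzero    (fsuc b) e = ⊥-elim (head-fresh f d b e)
  distinct⇒injective f d (fsuc a) fzero    e = ⊥-elim (head-fresh f d a (sym e))
  distinct⇒injective f d (fsuc a) (fsuc b) e =
    cong fsuc (distinct⇒injective (f ∘ fsuc) (∧-trueʳ {not (f fzero ∈ᵇ tabulate (f ∘ fsuc))} d) a b e)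

toList-tabulate : {A : Set} → ∀ {N} (f : Fin N → A) → Vec.toList (Vec.tabulate f) ≡ tabulate f
toList-tabulate {N = zero}  f = refl
toList-tabulate {N = suc N} f = cong (f fzero ∷_) (toList-tabulate (f ∘ fsuc))

toList-lookup : {A : Set} → ∀ {N} (w : Vec A N) → Vec.toList w ≡ tabulate (Vec.lookup w)
toList-lookup []      = refl
toList-lookup (x ∷ w) = cong (x ∷_) (toList-lookup w)

tabulate-nth : ∀ {N} (f : Fin N → Bool) l → length l ≡ N → (∀ i → f i ≡ nth l (toℕ i)) → tabulate f ≡ l
tabulate-nth {zero}  f []      _   _ = refl
tabulate-nth {suc N} f (b ∷ l) ∣l∣ h = cong₂ _∷_ (h fzero) (tabulate-nth (f ∘ fsuc) l (suc-injective ∣l∣) (h ∘ fsuc))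

nth-map-tabulate : {A : Set} → ∀ {N} (h : Fin N → A) (f : A → Bool) (a : Fin N) → nth (map f (tabulate h)) (toℕ a) ≡ f (h a)
nth-map-tabulate h f fzero    = refl
nth-map-tabulate h f (fsuc a) = nth-map-tabulate (h ∘ fsuc) f a

nth-++-inside : ∀ c r b → r < length c → nth (c ++ b ∷ []) r ≡ nth c r
nth-++-inside (x ∷ c) zero    b _         = refl
nth-++-inside (x ∷ c) (suc r) b (s≤s r<c) = nth-++-inside c r b r<c

nth-++-last : ∀ c b → nth (c ++ b ∷ []) (length c) ≡ b
nth-++-last []      b = refl
nth-++-last (x ∷ c) b = nth-++-last c b

nth-not : ∀ c r → r < length c → nth (map not c) r ≡ not (nth c r)
nth-not (x ∷ c) zero    _         = refl
nth-not (x ∷ c) (suc r) (s≤s r<c) = nth-not c r r<c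

≡ᵇ-true : ∀ a b → a ≡ b → (a ≡ᵇ b) ≡ true
≡ᵇ-true a b a≡b = dec-true (a ≟ b) a≡b

≡ᵇ-false : ∀ a b → a ≢ b → (a ≡ᵇ b) ≡ false
≡ᵇ-false a b a≢b = dec-false (a ≟ b) a≢b

if-then-false : ∀ b → (if b then false else true) ≡ not b
if-then-false true  = refl
if-then-false false = refl

module _ {N : ℕ} where

  -- position r+2 is b+1 for some b ∈ 𝓑(w)  iff  letter a (with toℕ a = r) is marked
  any-Bset : ∀ r (a : Fin N) → toℕ a ≡ r → ∀ l →
    any (λ b → suc (suc r) ≡ᵇ suc b) (map (λ j → suc (toℕ j)) l) ≡ a ∈ᵇ l
  any-Bset r a ta≡r []      = refl
  any-Bset r a ta≡r (y ∷ l) = cong₂ _∨_ same (any-Bset r a ta≡r l)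
    where
    same : (r ≡ᵇ toℕ y) ≡ (y == a)
    same with y FinP.≟ a
    ... | yes y≡a = ≡ᵇ-true r (toℕ y) (trans (sym ta≡r) (cong toℕ (sym y≡a)))
    ... | no y≢a  = ≡ᵇ-false r (toℕ y) (λ r≡ty → y≢a (FinP.toℕ-injective (trans (sym r≡ty) (sym ta≡r))))

  any-Bset-first : ∀ l → any (λ b → 1 ≡ᵇ suc b) (map (λ (j : Fin N) → suc (toℕ j)) l) ≡ false
  any-Bset-first []      = refl
  any-Bset-first (y ∷ l) = any-Bset-first l

module _ (n : ℕ) (w : Vec (Fin (2 * n)) (2 * n)) (d : distinct (Vec.toList w) ≡ true) where
  private
    N : ℕ
    N = 2 * n
    t : List (Fin N)
    t = Vec.toList w
    ∣t∣ : length t ≡ N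
    ∣t∣ = VecP.length-toList w
    w-injective : ∀ a b → Vec.lookup w a ≡ Vec.lookup w b → a ≡ b
    w-injective = distinct⇒injective (Vec.lookup w) (subst (λ z → distinct z ≡ true) (toList-lookup w) d)
    positions : List (Fin N)
    positions = crossout N (λ i → toℕ (Vec.lookup w i)) (allFin N)
    values-of-positions : map (Vec.lookup w) positions ≡ bLetters t
    values-of-positions = trans (crossout-relabel (Vec.lookup w) w-injective N (allFin N))
      (trans (cong (crossout N toℕ) (trans (LP.map-tabulate id (Vec.lookup w)) (sym (toList-lookup w))))
             (cong (λ k → crossout k toℕ t) (sym ∣t∣)))
    steps : List Bool
    steps = true ∷ map not (marks t) ++ false ∷ []
    ∣middle∣ : length (map not (marks t)) ≡ N
    ∣middle∣ = trans (LP.length-map not (marks t)) (trans (LP.length-map _ t) ∣t∣)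

    entry : ∀ r → r < 2 * n + 2 →
      (if (suc r ≡ᵇ (2 * n + 2)) ∨ any (λ b → suc r ≡ᵇ suc b) (Bset w) then false else true) ≡ nth steps r
    entry zero _ rewrite ≡ᵇ-false 1 (2 * n + 2) (λ e → 1+n≢0 (sym (suc-injective (trans e (+-comm (2 * n) 2)))))
                       | any-Bset-first {N} positions = refl
    entry (suc r) r<N+2 with r ≟ N
    ... | yes r≡N rewrite ≡ᵇ-true (suc (suc r)) (2 * n + 2) (trans (cong (suc ∘ suc) r≡N) (+-comm 2 (2 * n))) =
      sym (trans (cong (nth (map not (marks t) ++ false ∷ [])) (trans r≡N (sym ∣middle∣)))
                 (nth-++-last (map not (marks t)) false))
    ... | no r≢N = trans (cong₂ (λ a b → if a ∨ b then false else true) not-last is-B)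
                         (trans (if-then-false _) (sym middle))
      where
      r<N : r < N
      r<N = ≤∧≢⇒< (≤-pred (≤-pred (≤-trans r<N+2 (≤-reflexive (+-comm (2 * n) 2))))) r≢N
      a : Fin N
      a = fromℕ< r<N
      ta≡r : toℕ a ≡ r
      ta≡r = FinP.toℕ-fromℕ< r<N
      not-last : (suc (suc r) ≡ᵇ (2 * n + 2)) ≡ false
      not-last = ≡ᵇ-false _ _ (λ e → r≢N (suc-injective (suc-injective (trans e (+-comm (2 * n) 2)))))
      is-B : any (λ b → suc (suc r) ≡ᵇ suc b) (Bset w) ≡ Vec.lookup w a ∈ᵇ bLetters t
      is-B = trans (any-Bset r a ta≡r positions)
                   (trans (sym (∈ᵇ-relabel (Vec.lookup w) w-injective a positions))
                          (cong (Vec.lookup w a ∈ᵇ_) values-of-positions))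
      middle : nth steps (suc r) ≡ not (Vec.lookup w a ∈ᵇ bLetters t)
      middle = trans (nth-++-inside (map not (marks t)) r false (subst (r <_) (sym ∣middle∣) r<N))
        (trans (nth-not (marks t) r (subst (r <_) (sym (trans (LP.length-map _ t) ∣t∣)) r<N))
          (cong not (trans (cong (λ z → nth (map (_∈ᵇ bLetters t) z) r) (toList-lookup w))
            (trans (cong (nth (map (_∈ᵇ bLetters t) (tabulate (Vec.lookup w)))) (sym ta≡r))
                   (nth-map-tabulate (Vec.lookup w) (_∈ᵇ bLetters t) a)))))

  pB-steps : Vec.toList (pB n w) ≡ true ∷ map not (marks (Vec.toList w)) ++ false ∷ []
  pB-steps = trans (toList-tabulate _)
    (tabulate-nth _ steps (trans (cong suc (trans (LP.length-++ (map not (marks t))) (cong (_+ 1) ∣middle∣))) (sym (+-suc N 1)))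
                  (λ i → entry (toℕ i) (FinP.toℕ<n i)))

descent : ∀ h l → DyckFrom (suc h) l →
  Σ (List Bool) λ s → (l ≡ map not s ++ false ∷ []) × (downs s ≡ h + ups s)
descent h (true ∷ l) d with descent (suc h) l d
... | s , l≡ , bal = false ∷ s , cong (true ∷_) l≡ , trans bal (sym (+-suc h (ups s)))
descent (suc h) (false ∷ l) d with descent h l d
... | s , l≡ , bal = true ∷ s , cong (false ∷_) l≡ , cong suc bal
descent zero (false ∷ []) _ = [] , refl , refl
descent zero (false ∷ true ∷ l) d with descent zero l d
... | s , l≡ , bal = true ∷ false ∷ s , cong (λ z → false ∷ true ∷ z) l≡ , cong suc bal

dyck-decompose : ∀ l → DyckFrom 0 l → 1 ≤ length l →
  Σ (List Bool) λ s → (l ≡ true ∷ map not s ++ false ∷ []) × (downs s ≡ ups s)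
dyck-decompose (true ∷ l) d _ with descent 0 l d
... | s , l≡ , bal = s , cong (true ∷_) l≡ , bal

length-downs-ups : ∀ s → length s ≡ downs s + ups s
length-downs-ups []          = refl
length-downs-ups (true ∷ s)  = cong suc (length-downs-ups s)
length-downs-ups (false ∷ s) = trans (cong suc (length-downs-ups s)) (sym (+-suc (downs s) (ups s)))

middle-length : ∀ n (β : Vec Bool (2 * n + 2)) s → Vec.toList β ≡ true ∷ map not s ++ false ∷ [] → length s ≡ 2 * n
middle-length n β s β-steps = +-cancelʳ-≡ 2 (length s) (2 * n)
  (trans (+-suc (length s) 1)
    (trans (cong suc (trans (cong (_+ 1) (sym (LP.length-map not s))) (sym (LP.length-++ (map not s)))))
           (trans (cong length (sym β-steps)) (VecP.length-toList β))))

balanced-downs : ∀ n s → length s ≡ 2 * n → downs s ≡ ups s → downs s ≡ n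
balanced-downs n s ∣s∣ bal = *-cancelˡ-≡ (downs s) n 2
  (trans (cong (downs s +_) (trans (+-identityʳ (downs s)) bal)) (trans (sym (length-downs-ups s)) ∣s∣))

toList-nonempty : ∀ n (β : Vec Bool (2 * n + 2)) → 1 ≤ length (Vec.toList β)
toList-nonempty n β = subst (1 ≤_) (sym (VecP.length-toList β)) (≤-trans (n≤1+n 1) (m≤n+m 2 (2 * n)))

hasUp-steps : ∀ s → any id (map not s ++ false ∷ []) ≡ hasUp s
hasUp-steps []      = refl
hasUp-steps (b ∷ s) = cong (not b ∨_) (hasUp-steps s)

if-hStar : ∀ h b → (if b then h else h ∸ 1) ≡ hStar h b
if-hStar h true  = refl
if-hStar h false = refl

hStars-weight : ∀ h s → product (take (downs s) (hStarsFrom h (map not s ++ false ∷ []))) ≡ weight h s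
hStars-weight h []          = refl
hStars-weight h (false ∷ s) = hStars-weight (suc h) s
hStars-weight h (true ∷ s)  =
  cong₂ _*_ (trans (cong (λ b → if b then h else h ∸ 1) (hasUp-steps s)) (if-hStar h (hasUp s)))
            (hStars-weight (h ∸ 1) s)

length-filter : {A : Set} {P : A → Set} (P? : ∀ x → Dec (P x)) → ∀ xs → length (filter P? xs) ≡ count (does ∘ P?) xs
length-filter P? []       = refl
length-filter P? (x ∷ xs) with does (P? x)
... | true  = cong suc (length-filter P? xs)
... | false = length-filter P? xs

count-allWords : ∀ m k (q : List (Fin m) → Bool) → count (q ∘ Vec.toList) (allWords m k) ≡ count q (words m k)
count-allWords m zero    q = refl
count-allWords m (suc k) q =
  trans (count-concatMap _ (λ x → map (x ∷_) (allWords m k)) (allFin m))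
    (trans (ΣList-tabulate _ m id)
      (trans (ΣFin-cong m (λ x → trans (count-map _ (x ∷_) (allWords m k)) (count-allWords m k (λ t → q (x ∷ t)))))
             (sym (count-words-suc k q))))

module _ (n : ℕ) (β : Vec Bool (2 * n + 2)) (s : List Bool)
         (β-steps : Vec.toList β ≡ true ∷ map not s ++ false ∷ []) where
  open import Data.List.Relation.Unary.Unique.DecPropositional (FinP._≟_ {2 * n}) using (unique?)

  counted-iff-valid : ∀ w → (does (unique? (Vec.toList w)) ∧ does (VecP.≡-dec BoolP._≟_ (pB n w) β))
                            ≡ valid (λ _ → true) s (Vec.toList w)
  counted-iff-valid w with unique? (Vec.toList w)
  ... | no not-unique with distinct (Vec.toList w) in d
  ...   | true  = ⊥-elim (not-unique (distinct⇒Unique _ d))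
  ...   | false = refl
  counted-iff-valid w | yes unique rewrite Unique⇒distinct _ unique | allIn-everything (Vec.toList w)
    with VecP.≡-dec BoolP._≟_ (pB n w) β
  ... | yes pB≡β = sym (subst (λ z → listEq z s ≡ true) (sym marks≡s) (listEq-refl s))
    where
    steps≡ : true ∷ map not (marks (Vec.toList w)) ++ false ∷ [] ≡ true ∷ map not s ++ false ∷ []
    steps≡ = trans (sym (pB-steps n w (Unique⇒distinct _ unique))) (trans (cong Vec.toList pB≡β) β-steps)
    marks≡s : marks (Vec.toList w) ≡ s
    marks≡s = LP.map-injective BoolP.not-injective (LP.++-cancelʳ (false ∷ []) _ _ (LP.∷-injectiveʳ steps≡))
  ... | no pB≢β with listEq (marks (Vec.toList w)) s in eq
  ...   | false = refl
  ...   | true  = ⊥-elim (pB≢β (trans (sym (VecP.cast-is-id refl (pB n w)))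
                    (VecP.toList-injective refl (pB n w) β
                      (trans (pB-steps n w (Unique⇒distinct _ unique))
                             (trans (cong (λ c → true ∷ map not c ++ false ∷ []) (listEq-sound _ _ eq)) (sym β-steps))))))

  countPB-valid : countPB n β ≡ count (valid (λ _ → true) s) (words (2 * n) (2 * n))
  countPB-valid =
    trans (length-filter (λ w → unique? (Vec.toList w) ×-dec VecP.≡-dec BoolP._≟_ (pB n w) β) (allWords (2 * n) (2 * n)))
      (trans (count-cong _ _ counted-iff-valid (allWords (2 * n) (2 * n)))
             (count-allWords (2 * n) (2 * n) (valid (λ _ → true) s)))

theorem4 : (n : ℕ) → n ≥ 1 → (β : Vec Bool (2 * n + 2)) → IsDyck β →
    countPB n β ≡ oddProd n * product (take n (hStars β))
theorem4 n _ β dyck with dyck-decompose (Vec.toList β) dyck (toList-nonempty n β)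
... | s , β-steps , bal = begin
    countPB n β
  ≡⟨ countPB-valid n β s β-steps ⟩
    count (valid all s) (words (2 * n) (2 * n))
  ≡⟨ cong (λ k → count (valid all s) (words (2 * n) k)) (sym (double≡2* n)) ⟩
    count (valid all s) (words (2 * n) (double n))
  ≡⟨ count-formula n all s (trans (ΣFin-const-1 (2 * n)) (sym (double≡2* n))) (trans ∣s∣ (sym (double≡2* n))) bal ⟩
    oddProd n * weight 1 s
  ≡⟨ cong (oddProd n *_) (sym hStars≡weight) ⟩
    oddProd n * product (take n (hStars β)) ∎
  where
  open ≡-Reasoning
  all : Fin (2 * n) → Bool
  all _ = true
  ∣s∣ : length s ≡ 2 * n
  ∣s∣ = middle-length n β s β-steps
  -- hStars β starts with the h* of the down steps of s, n of them
  hStars≡weight : product (take n (hStars β)) ≡ weight 1 s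
  hStars≡weight = trans (cong (λ l → product (take n (hStarsFrom 0 l))) β-steps)
    (trans (cong (λ k → product (take k (hStarsFrom 1 (map not s ++ false ∷ []))))
                 (sym (balanced-downs n s ∣s∣ bal)))
           (hStars-weight 1 s))
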